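{- Let $S$ be a decision rule system, let $C\in\{AR,AD,SR\}$, and let $\Gamma$ be an e-tree over $S$ that solves the problem $EC(S)$ (i.e. $EAR(S)$, $EAD(S)$, $ESR(S)$ respectively). Then the o-tree $o(\Gamma)$ solves the problem $C(S)$.
   Context: Let $\omega=\{0,1,2,\dots\}$ and let $\{a_i:i\in\omega\}$ be a set of attributes. A decision rule $r$ is an expression $(a_{i_1}=\delta_1)\wedge\cdots\wedge(a_{i_m}=\delta_m)\to\sigma$ with $m\in\omega$, pairwise different attributes, and $\delta_j,\sigma\in\omega$. Its length is $m$, its right-hand side is $\sigma$, $A(r)=\{a_{i_1},\dots,a_{i_m}\}$, and $K(r)=\{a_{i_1}=\delta_1,\dots,a_{i_m}=\delta_m\}$. Two rules are equal iff they have the same $K(\cdot)$ and the same right-hand side. A decision rule system $S$ is a finite nonempty set of decision rules. Let $A(S)=\bigcup_{r\in S}A(r)$ and let $D(Z)$ be the set of right-hand sides of rules in $Z\subseteq S$. For $a_i\in A(S)$, $V_S(a_i)=\{\delta:(a_i=\delta)\in\bigcup_{r\in S}K(r)\}$ and $EV_S(a_i)=V_S(a_i)\cup\{*\}$, where $*$ is a symbol not in $\omega$. A set of equations $\{a_{i_1}=\delta_1,\dots,a_{i_m}=\delta_m\}$ with $\delta_j\in\omega\cup\{*\}$ is inconsistent if there are $l\ne t$ with $i_l=i_t$ and $\delta_l\neq\delta_t$, and consistent otherwise. A decision tree over $S$ is a finite directed rooted tree with working nodes labeled by attributes from $A(S)$ and terminal nodes labeled by subsets of $S$. In an o-tree,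 a working node labeled $a_i$ has exactly $|V_S(a_i)|$ outgoing edges, labeled with pairwise distinct elements of $V_S(a_i)$. In an e-tree, it has exactly $|EV_S(a_i)|$ outgoing edges, labeled with pairwise distinct elements of $EV_S(a_i)$. For a complete path $\xi$ (root to terminal node), $K(\xi)$ is the set of equations $a_i=\delta$ with $a_i$ labeling a working node of $\xi$ and $\delta$ labeling the edge of $\xi$ leaving it. $\tau(\xi)$ is the label of the terminal node of $\xi$. An o-tree (resp. e-tree) solves $AR(S)$ (resp. $EAR(S)$) if every complete path $\xi$ with $K(\xi)$ consistent satisfies: $K(r)\subseteq K(\xi)$ for all $r\in\tau(\xi)$, and $K(r)\cup K(\xi)$ is inconsistent for all $r\in S\setminus\tau(\xi)$. It solves $AD(S)$ (resp. $EAD(S)$) if every such $\xi$ satisfies: $K(r)\subseteq K(\xi)$ for $r\in\tau(\xi)$, and $K(r)\cup K(\xi)$ is inconsistent for each $r\in S\setminus\tau(\xi)$ whose right-hand side is not in $D(\tau(\xi))$. It solves $SR(S)$ (resp. $ESR(S)$) if every such $\xi$ satisfies: $K(r)\subseteq K(\xi)$ for $r\in\tau(\xi)$, and if $\tau(\xi)=\emptyset$ then $K(r)\cup K(\xi)$ is inconsistent for all $r\in S$. For an e-tree $\Gamma$ over $S$, $o(\Gamma)$ denotes the o-tree over $S$ obtained from $\Gamma$ by removing every node $v$ such that the path from the root to $v$ contains an edge labeled $*$, together with all edges entering or leaving such nodes. -}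

module Defs where

open import Data.Nat using (ℕ; suc)
open import Data.Fin using (Fin)
open import Data.Fin.Subset using (Subset; _∈_; _∉_)
open import Data.Maybe using (Maybe; just; nothing)
open import Data.Product using (Σ; ∃; ∃-syntax; _×_; _,_; proj₁; proj₂)
open import Data.Sum using (_⊎_)
open import Data.List using (List; []; _∷_; _++_; map)
open import Data.List.Relation.Unary.All using (All)
open import Data.List.Relation.Unary.Unique.Propositional using (Unique)
import Data.List.Membership.Propositional as LM
open import Relation.Binary.PropositionalEquality using (_≡_; _≢_)
open import Relation.Nullary using (¬_)
open import Function.Bundles using (_⇔_)

-- Values ω ∪ {*}: `just δ` is δ ∈ ω, `nothing` is the symbol *.
Val : Set
Val = Maybe ℕ

-- An equation a_i = δ is the pair (i , δ).
Eq : Set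
Eq = ℕ × Val

-- A decision rule: K(r) as a list of equations (i , δ) with pairwise
-- different attributes, and right-hand side σ.
record Rule : Set where
  field
    conds    : List (ℕ × ℕ)
    distinct : Unique (map proj₁ conds)
    rhs      : ℕ
open Rule public

K : Rule → List Eq
K r = map (λ p → proj₁ p , just (proj₂ p)) (conds r)

RuleEq : Rule → Rule → Set
RuleEq r r' = (∀ p → p LM.∈ conds r → p LM.∈ conds r')
            × (∀ p → p LM.∈ conds r' → p LM.∈ conds r)
            × rhs r ≡ rhs r'

-- A decision rule system with m elements: S is given as an enumeration
-- Fin m → Rule of pairwise different rules (so it is a set).
DistinctRules : ∀ {m} → (Fin m → Rule) → Set
DistinctRules {m} S = ∀ i j → RuleEq (S i) (S j) → i ≡ j

_∈A_ : ∀ {m} → ℕ → (Fin m → Rule) → Set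
a ∈A S = ∃[ j ] ∃[ δ ] ((a , δ) LM.∈ conds (S j))

InV : ∀ {m} → (Fin m → Rule) → ℕ → ℕ → Set
InV S a δ = ∃[ j ] ((a , δ) LM.∈ conds (S j))

InEV : ∀ {m} → (Fin m → Rule) → ℕ → Val → Set
InEV S a v = v ≡ nothing ⊎ Σ ℕ (λ δ → v ≡ just δ × InV S a δ)

InVlab : ∀ {m} → (Fin m → Rule) → ℕ → Val → Set
InVlab S a v = Σ ℕ (λ δ → v ≡ just δ × InV S a δ)

-- Trees: working nodes labeled by attribute index with a list of
-- (edge label , subtree); terminal nodes labeled by subsets of S
-- (subsets of the index set Fin m).
data Tree (m : ℕ) : Set where
  leaf : Subset m → Tree m
  node : ℕ → List (Val × Tree m) → Tree m

labels : ∀ {m} → List (Val × Tree m) → List Val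
labels = map proj₁

data IsETree {m} (S : Fin m → Rule) : Tree m → Set where
  leaf : ∀ τ → IsETree S (leaf τ)
  node : ∀ a es → a ∈A S → Unique (labels es)
       → (∀ v → (v LM.∈ labels es) ⇔ InEV S a v)
       → All (λ e → IsETree S (proj₂ e)) es
       → IsETree S (node a es)

data IsOTree {m} (S : Fin m → Rule) : Tree m → Set where
  leaf : ∀ τ → IsOTree S (leaf τ)
  node : ∀ a es → a ∈A S → Unique (labels es)
       → (∀ v → (v LM.∈ labels es) ⇔ InVlab S a v)
       → All (λ e → IsOTree S (proj₂ e)) es
       → IsOTree S (node a es)

mutual
  o : ∀ {m} → Tree m → Tree m
  o (leaf τ) = leaf τ
  o (node a es) = node a (oEdges es)

  oEdges : ∀ {m} → List (Val × Tree m) → List (Val × Tree m)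
  oEdges [] = []
  oEdges ((nothing , t) ∷ es) = oEdges es
  oEdges ((just δ , t) ∷ es) = (just δ , o t) ∷ oEdges es

-- Complete paths: CPath t Kξ τ means there is a complete path ξ in t
-- with K(ξ) = Kξ (listed from the root) and τ(ξ) = τ.
data CPath {m} : Tree m → List Eq → Subset m → Set where
  leaf : ∀ τ → CPath (leaf τ) [] τ
  step : ∀ {a es v t Kξ τ} → (v , t) LM.∈ es → CPath t Kξ τ
       → CPath (node a es) ((a , v) ∷ Kξ) τ

Inconsistent : List Eq → Set
Inconsistent L = ∃[ i ] ∃[ δ ] ∃[ δ' ]
  ((i , δ) LM.∈ L × (i , δ') LM.∈ L × δ ≢ δ')

Consistent : List Eq → Set
Consistent L = ¬ Inconsistent L

_⊆E_ : List Eq → List Eq → Set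
L ⊆E L' = ∀ e → e LM.∈ L → e LM.∈ L'

InD : ∀ {m} → (Fin m → Rule) → Subset m → ℕ → Set
InD S τ σ = ∃[ j ] (j ∈ τ × rhs (S j) ≡ σ)

data Problem : Set where
  AR AD SR : Problem

-- The second condition of each problem, for path equations Kξ and label τ.
Cond : ∀ {m} → Problem → (Fin m → Rule) → List Eq → Subset m → Set
Cond AR S Kξ τ = ∀ j → j ∉ τ → Inconsistent (K (S j) ++ Kξ)
Cond AD S Kξ τ = ∀ j → j ∉ τ → ¬ InD S τ (rhs (S j)) → Inconsistent (K (S j) ++ Kξ)
Cond SR S Kξ τ = (∀ j → j ∉ τ) → ∀ j → Inconsistent (K (S j) ++ Kξ)

-- t solves C(S) (if t is an o-tree) / EC(S) (if t is an e-tree).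
Solves : ∀ {m} → (Fin m → Rule) → Problem → Tree m → Set
Solves S C t = ∀ Kξ τ → CPath t Kξ τ → Consistent Kξ
  → (∀ j → j ∈ τ → K (S j) ⊆E Kξ) × Cond C S Kξ τ

{-# OPTIONS --safe #-}
-- Every complete path of o(Γ) is a complete path of Γ with the same equations and terminal label, and every
-- working node of o(Γ) keeps exactly the non-* edges of the corresponding node of Γ, i.e. the edge labels
-- EV_S(a) ∖ {*} = V_S(a).
module Submission where

open import Defs
open import Data.Nat using (ℕ; suc)
open import Data.Fin using (Fin)
open import Data.Bool using (T)
open import Data.Product using (_×_; _,_; proj₁; proj₂; ∃-syntax)
open import Data.Maybe using (just; nothing; is-just)
open import Data.Sum using (inj₁; inj₂)
open import Data.Unit using (tt)
open import Data.List using (List; []; _∷_; filter)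
open import Data.List.Relation.Unary.All using (All; []; _∷_)
open import Data.List.Relation.Unary.Any using (here; there)
open import Data.List.Relation.Unary.Unique.Propositional using (Unique)
import Data.List.Relation.Unary.Unique.Propositional.Properties as Unique
open import Data.List.Membership.Propositional using (_∈_)
open import Data.List.Membership.Propositional.Properties using (∈-filter⁺; ∈-filter⁻)
open import Relation.Binary.PropositionalEquality using (_≡_; refl; sym; cong; subst)
open import Relation.Nullary.Decidable using (T?)
open import Function using (_∘_)
open import Function.Bundles using (_⇔_; mk⇔; Equivalence)

module _ {m : ℕ} where

  labels-oEdges : (es : List (Val × Tree m)) → labels (oEdges es) ≡ filter (T? ∘ is-just) (labels es)
  labels-oEdges []                  = refl
  labels-oEdges ((nothing , t) ∷ es) = labels-oEdges es
  labels-oEdges ((just δ , t) ∷ es) = cong (just δ ∷_) (labels-oEdges es)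

  ∈-oEdges⁻ : ∀ (es : List (Val × Tree m)) {v t′} → (v , t′) ∈ oEdges es → ∃[ t ] ((v , t) ∈ es × t′ ≡ o t)
  ∈-oEdges⁻ ((nothing , t) ∷ es) p = let t₀ , q , eq = ∈-oEdges⁻ es p in t₀ , there q , eq
  ∈-oEdges⁻ ((just δ , t) ∷ es) (here refl) = t , here refl , refl
  ∈-oEdges⁻ ((just δ , t) ∷ es) (there p) = let t₀ , q , eq = ∈-oEdges⁻ es p in t₀ , there q , eq

  CPath-o⁻ : ∀ {t t′ : Tree m} {Kξ τ} → t′ ≡ o t → CPath t′ Kξ τ → CPath t Kξ τ
  CPath-o⁻ {leaf _}    refl (leaf τ) = leaf τ
  CPath-o⁻ {node a es} refl (step e p) =
    let t₀ , e₀ , eq = ∈-oEdges⁻ es e in step e₀ (CPath-o⁻ eq p)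

  Solves-o : ∀ (S : Fin m → Rule) C {t} → Solves S C t → Solves S C (o t)
  Solves-o S C sol Kξ τ p = sol Kξ τ (CPath-o⁻ refl p)

  module _ (S : Fin m → Rule) where

    InEV×just⇔InVlab : ∀ a v → (InEV S a v × T (is-just v)) ⇔ InVlab S a v
    InEV×just⇔InVlab a v = mk⇔ to from
      where
        to : InEV S a v × T (is-just v) → InVlab S a v
        to (inj₁ refl , ())
        to (inj₂ x , _) = x
        from : InVlab S a v → InEV S a v × T (is-just v)
        from x@(_ , refl , _) = inj₂ x , tt

    ∈-labels-oEdges⇔InVlab : ∀ a es → (∀ v → v ∈ labels es ⇔ InEV S a v)
                           → ∀ v → v ∈ labels (oEdges es) ⇔ InVlab S a v
    ∈-labels-oEdges⇔InVlab a es labels⇔InEV v rewrite labels-oEdges es = mk⇔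
      (λ p → let q , j = ∈-filter⁻ (T? ∘ is-just) p
             in Equivalence.to (InEV×just⇔InVlab a v) (Equivalence.to (labels⇔InEV v) q , j))
      (λ x → let ev , j = Equivalence.from (InEV×just⇔InVlab a v) x
             in ∈-filter⁺ (T? ∘ is-just) (Equivalence.from (labels⇔InEV v) ev) j)

    mutual
      IsETree⇒IsOTree-o : ∀ {t} → IsETree S t → IsOTree S (o t)
      IsETree⇒IsOTree-o (leaf τ) = leaf τ
      IsETree⇒IsOTree-o (node a es a∈A unique labels⇔InEV subtrees) =
        node a (oEdges es) a∈A
             (subst Unique (sym (labels-oEdges es)) (Unique.filter⁺ (T? ∘ is-just) unique))
             (∈-labels-oEdges⇔InVlab a es labels⇔InEV)
             (All-IsOTree-oEdges subtrees)

      All-IsOTree-oEdges : ∀ {es} → All (IsETree S ∘ proj₂) es → All (IsOTree S ∘ proj₂) (oEdges es)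
      All-IsOTree-oEdges {[]}                 []       = []
      All-IsOTree-oEdges {(nothing , _) ∷ es} (_ ∷ ps) = All-IsOTree-oEdges ps
      All-IsOTree-oEdges {(just _ , _) ∷ es}  (p ∷ ps) = IsETree⇒IsOTree-o p ∷ All-IsOTree-oEdges ps

lemma1 : ∀ {n} (S : Fin (suc n) → Rule) → DistinctRules S
       → (C : Problem) (Γ : Tree (suc n))
       → IsETree S Γ → Solves S C Γ
       → IsOTree S (o Γ) × Solves S C (o Γ)
lemma1 S _ C Γ isETree solves = IsETree⇒IsOTree-o S isETree , Solves-o S C solves
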